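{- Let $G$ be a matroid on $[n]=\{1,\dots,n\}$ with no loops and no multiple points, and fix the natural linear order on $[n]$. Then the collection $\operatorname{nbb}(G)$ of nbb sets of $G$ is a simplicial complex (closed under taking subsets), and it contains the collection $\operatorname{nbc}(G)$ of nbc sets of $G$ as a subcomplex.
   Context: For $X\subseteq[n]$, $\operatorname{cl}(X)=\{i\in[n]: \operatorname{rk}(X\cup\{i\})=\operatorname{rk}(X)\}$ is the matroid closure. A subset $S\subseteq[n]$ is line-closed if $\operatorname{cl}(\{i,j\})\subseteq S$ for all $i,j\in S$. The line-closure $\operatorname{lc}(S)$ of $S$ is the intersection of all line-closed sets containing $S$. A broken circuit is a set $C-\min(C)$ with $C$ a circuit of $G$; an nbc set is a subset of $[n]$ containing no broken circuit. An increasing subset $S=\{i_1<\dots<i_p\}\subseteq[n]$ is nbb if $i_k=\min \operatorname{lc}(\{i_k,\dots,i_p\})$ for every $1\le k\le p$. -}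

module Defs where

open import Data.Nat using (ℕ; _≤_; _<_)
open import Data.Fin using (Fin; toℕ)
import Data.Fin as F
open import Data.Fin.Subset using (Subset; _∈_; _⊆_; _⊂_; _∪_; _∩_; ⁅_⁆; ∣_∣; _-_)
open import Data.Vec using (tabulate)
open import Data.Bool using (Bool)
open import Data.Nat using (_≤ᵇ_)
open import Data.Product using (Σ; _×_)
open import Relation.Binary.PropositionalEquality using (_≡_; _≢_)
open import Relation.Nullary using (¬_)

-- A matroid on the ground set Fin n (= [n], with the natural order of Fin),
-- given by its rank function satisfying the standard rank axioms.
record Matroid (n : ℕ) : Set where
  field
    rk          : Subset n → ℕ
    rk-bounded  : ∀ X → rk X ≤ ∣ X ∣
    rk-mono     : ∀ X Y → X ⊆ Y → rk X ≤ rk Y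
    rk-submod   : ∀ X Y → rk (X ∪ Y) Data.Nat.+ rk (X ∩ Y) ≤ rk X Data.Nat.+ rk Y

module _ {n : ℕ} (G : Matroid n) where
  open Matroid G

  Loopless : Set
  Loopless = ∀ i → rk ⁅ i ⁆ ≡ 1

  NoMultiplePoints : Set
  NoMultiplePoints = ∀ i j → i ≢ j → rk (⁅ i ⁆ ∪ ⁅ j ⁆) ≡ 2

  InClosure : Subset n → Fin n → Set
  InClosure X i = rk (X ∪ ⁅ i ⁆) ≡ rk X

  LineClosed : Subset n → Set
  LineClosed S = ∀ i j → i ∈ S → j ∈ S → ∀ k → InClosure (⁅ i ⁆ ∪ ⁅ j ⁆) k → k ∈ S

  InLineClosure : Subset n → Fin n → Set
  InLineClosure S k = ∀ T → S ⊆ T → LineClosed T → k ∈ T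

  Circuit : Subset n → Set
  Circuit C = (rk C < ∣ C ∣) × (∀ D → D ⊂ C → rk D ≡ ∣ D ∣)

  BrokenCircuit : Subset n → Set
  BrokenCircuit B = Σ (Subset n) λ C → Circuit C × Σ (Fin n) λ m →
    m ∈ C × (∀ j → j ∈ C → m F.≤ j) × (B ≡ C - m)

  NBC : Subset n → Set
  NBC S = ∀ B → BrokenCircuit B → ¬ (B ⊆ S)

  tailFrom : Subset n → Fin n → Subset n
  tailFrom S i = S ∩ tabulate (λ j → toℕ i ≤ᵇ toℕ j)

  -- nbb: for every i_k ∈ S, i_k = min lc({i_k,…,i_p}) (i_k ∈ lc of that set
  -- automatically, so it suffices that i_k ≤ every element of the line-closure)
  NBB : Subset n → Set
  NBB S = ∀ i → i ∈ S → ∀ k → InLineClosure (tailFrom S i) k → i F.≤ k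

{-# OPTIONS --safe #-}
module Submission where

-- The closure cl(X) of any set is line-closed, so lc(X) ⊆ cl(X).  Let S be
-- nbc, i ∈ S, and suppose some k < i lies in the closure of the tail
-- X = {j ∈ S : i ≤ j}.  Then X ∪ {k} is dependent and contains a circuit C;
-- since k lies below every element of X, the broken circuit C − min C is
-- contained in X ⊆ S, which is impossible.  Closure of both families under
-- subsets is monotonicity of the defining conditions.

open import Defs
open import Data.Nat using (ℕ)
open import Data.Fin.Subset using (Subset; _⊆_)
open import Data.Product using (_×_)

open import Data.Bool using (Bool; T)
open import Data.Bool.Properties using (T-≡)
open import Data.Empty using (⊥-elim)
open import Data.Fin as Fin using (Fin; toℕ)
open import Data.Fin.Subset
  using (_∈_; _∉_; _∪_; _∩_; _─_; _-_; ⁅_⁆; ∣_∣; inside; outside)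
open import Data.Fin.Subset.Properties
open import Data.Nat as ℕ using (_+_; _<_; _≤_; z≤n; s≤s)
open import Data.Nat.Induction using (<-wellFounded)
open import Data.Nat.Properties
open import Data.Product using (∃; _,_; proj₁; proj₂)
open import Data.Sum using (inj₁; inj₂)
open import Data.Vec using (tabulate; _∷_; here; there)
open import Data.Vec.Properties using (lookup∘tabulate; []=⇒lookup; lookup⇒[]=)
open import Function using (id; _∘_)
open import Function.Bundles using (Equivalence)
open import Induction.WellFounded using (Acc; acc)
open import Relation.Nullary using (¬_; yes; no)
open import Relation.Nullary.Decidable using (isYes; toWitness; fromWitness; _×-dec_)
open import Relation.Binary.PropositionalEquality using (_≢_; refl; sym; trans; subst)

module _ {n : ℕ} where

  ∪-least : {p q r : Subset n} → p ⊆ r → q ⊆ r → p ∪ q ⊆ r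
  ∪-least {p} {q} p⊆r q⊆r x∈p∪q with x∈p∪q⁻ p q x∈p∪q
  ... | inj₁ x∈p = p⊆r x∈p
  ... | inj₂ x∈q = q⊆r x∈q

  ∩-greatest : {p q r : Subset n} → r ⊆ p → r ⊆ q → r ⊆ p ∩ q
  ∩-greatest r⊆p r⊆q x∈r = x∈p∩q⁺ (r⊆p x∈r , r⊆q x∈r)

  ⁅x⁆⊆p : {x : Fin n} {p : Subset n} → x ∈ p → ⁅ x ⁆ ⊆ p
  ⁅x⁆⊆p {x} {p} x∈p y∈⁅x⁆ = subst (_∈ p) (sym (x∈⁅y⁆⇒x≡y x y∈⁅x⁆)) x∈p

  x∈tabulate⁻ : (f : Fin n → Bool) {x : Fin n} → x ∈ tabulate f → T (f x)
  x∈tabulate⁻ f {x} x∈ =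
    Equivalence.from T-≡ (trans (sym (lookup∘tabulate f x)) ([]=⇒lookup x∈))

  x∈tabulate⁺ : (f : Fin n → Bool) {x : Fin n} → T (f x) → x ∈ tabulate f
  x∈tabulate⁺ f {x} fx =
    lookup⇒[]= x (tabulate f) (trans (lookup∘tabulate f x) (Equivalence.to T-≡ fx))

x∈p─q⇒x∉q : ∀ {n} {p q : Subset n} {x : Fin n} → x ∈ p ─ q → x ∉ q
x∈p─q⇒x∉q {p = _ ∷ _} {inside ∷ _} {Fin.zero} () _
x∈p─q⇒x∉q {p = _ ∷ _} {outside ∷ _} {Fin.zero} _ ()
x∈p─q⇒x∉q {p = _ ∷ p} {_ ∷ q} {Fin.suc x} (there x∈) (there x∈q) =
  x∈p─q⇒x∉q {p = p} {q} x∈ x∈q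

x∈p-y⇒x≢y : ∀ {n} {p : Subset n} {x y : Fin n} → x ∈ p - y → x ≢ y
x∈p-y⇒x≢y {p = p} {y = y} x∈ refl = x∈p─q⇒x∉q {p = p} x∈ (x∈⁅x⁆ y)

least-∈ : ∀ {n} (p : Subset n) → 0 < ∣ p ∣ →
          ∃ λ m → m ∈ p × (∀ j → j ∈ p → m Fin.≤ j)
least-∈ (inside ∷ p) _ = Fin.zero , here , λ _ _ → z≤n
least-∈ (outside ∷ p) 0<∣p∣ with least-∈ p 0<∣p∣
... | m , m∈p , m≤ = Fin.suc m , there m∈p , λ { (Fin.suc j) (there j∈p) → s≤s (m≤ j j∈p) }

StrictLowerBound : ∀ {n} → Fin n → Subset n → Set
StrictLowerBound k X = ∀ j → j ∈ X → k Fin.< j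

-- Removing the least element m of C ⊆ X ∪ {k} leaves X: if k survived, then
-- m ∈ X would be both below and above k.
drop-least-⊆ : ∀ {n} {C X : Subset n} {k m : Fin n} →
  C ⊆ X ∪ ⁅ k ⁆ → StrictLowerBound k X →
  m ∈ C → (∀ j → j ∈ C → m Fin.≤ j) → C - m ⊆ X
drop-least-⊆ {C = C} {X} {k} {m} C⊆X∪k k<X m∈C m≤C {j} j∈C-m
  with j∈C ← p─q⊆p C ⁅ m ⁆ j∈C-m | x∈p∪q⁻ X ⁅ k ⁆ (C⊆X∪k j∈C)
... | inj₁ j∈X = j∈X
... | inj₂ j∈⁅k⁆ with refl ← x∈⁅y⁆⇒x≡y k j∈⁅k⁆ | x∈p∪q⁻ X ⁅ k ⁆ (C⊆X∪k m∈C)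
...   | inj₁ m∈X = ⊥-elim (<-irrefl refl (<-≤-trans (k<X m m∈X) (m≤C j j∈C)))
...   | inj₂ m∈⁅k⁆ = ⊥-elim (x∈p-y⇒x≢y {p = C} j∈C-m (sym (x∈⁅y⁆⇒x≡y k m∈⁅k⁆)))

module _ {n : ℕ} (G : Matroid n) where
  open Matroid G

  rk-submod-⊆ : ∀ {W Y Z} → W ⊆ Y → W ⊆ Z → rk (Y ∪ Z) + rk W ≤ rk Y + rk Z
  rk-submod-⊆ {W} {Y} {Z} W⊆Y W⊆Z =
    ≤-trans (+-monoʳ-≤ (rk (Y ∪ Z)) (rk-mono W (Y ∩ Z) (∩-greatest W⊆Y W⊆Z)))
            (rk-submod Y Z)

  rk-∪-absorb : ∀ {W Y Z} → W ⊆ Y → W ⊆ Z → rk Z ≤ rk W → rk (Y ∪ Z) ≤ rk Y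
  rk-∪-absorb {W} {Y} {Z} W⊆Y W⊆Z rkZ≤rkW =
    +-cancelʳ-≤ (rk W) (rk (Y ∪ Z)) (rk Y)
      (≤-trans (rk-submod-⊆ W⊆Y W⊆Z) (+-monoʳ-≤ (rk Y) rkZ≤rkW))

  inClosure? : Subset n → Fin n → Bool
  inClosure? X j = isYes (rk (X ∪ ⁅ j ⁆) ≟ rk X)

  cl : Subset n → Subset n
  cl X = tabulate (inClosure? X)

  ∈cl⁻ : ∀ {X j} → j ∈ cl X → InClosure G X j
  ∈cl⁻ {X} {j} j∈ = toWitness {a? = rk (X ∪ ⁅ j ⁆) ≟ rk X} (x∈tabulate⁻ (inClosure? X) j∈)

  ∈cl⁺ : ∀ {X j} → InClosure G X j → j ∈ cl X
  ∈cl⁺ {X} {j} e = x∈tabulate⁺ (inClosure? X) (fromWitness {a? = rk (X ∪ ⁅ j ⁆) ≟ rk X} e)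

  rk-∪≤⇒∈cl : ∀ {X j} → rk (X ∪ ⁅ j ⁆) ≤ rk X → j ∈ cl X
  rk-∪≤⇒∈cl {X} le = ∈cl⁺ (≤-antisym le (rk-mono X _ (p⊆p∪q _)))

  X⊆clX : ∀ X → X ⊆ cl X
  X⊆clX X j∈X = rk-∪≤⇒∈cl (rk-mono _ X (∪-least id (⁅x⁆⊆p j∈X)))

  clX-lineClosed : ∀ X → LineClosed G (cl X)
  clX-lineClosed X i j i∈ j∈ k k∈cl[ij] = rk-∪≤⇒∈cl (begin
    rk (X ∪ ⁅ k ⁆)                   ≤⟨ rk-mono _ _ X∪k⊆ ⟩
    rk ((X ∪ ij) ∪ (ij ∪ ⁅ k ⁆))     ≤⟨ rk-∪-absorb (q⊆p∪q X ij) (p⊆p∪q _) (≤-reflexive k∈cl[ij]) ⟩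
    rk (X ∪ ij)                      ≤⟨ rk-mono _ _ X∪ij⊆ ⟩
    rk ((X ∪ ⁅ i ⁆) ∪ (X ∪ ⁅ j ⁆))  ≤⟨ rk-∪-absorb (p⊆p∪q _) (p⊆p∪q _) (≤-reflexive (∈cl⁻ j∈)) ⟩
    rk (X ∪ ⁅ i ⁆)                   ≡⟨ ∈cl⁻ i∈ ⟩
    rk X                             ∎)
    where
    open ≤-Reasoning
    ij = ⁅ i ⁆ ∪ ⁅ j ⁆
    X∪k⊆ : X ∪ ⁅ k ⁆ ⊆ (X ∪ ij) ∪ (ij ∪ ⁅ k ⁆)
    X∪k⊆ = ∪-least (p⊆p∪q _ ∘ p⊆p∪q _) (q⊆p∪q _ _ ∘ q⊆p∪q _ _)
    X∪ij⊆ : X ∪ ij ⊆ (X ∪ ⁅ i ⁆) ∪ (X ∪ ⁅ j ⁆)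
    X∪ij⊆ = ∪-least (p⊆p∪q _ ∘ p⊆p∪q _)
                    (∪-least (p⊆p∪q _ ∘ q⊆p∪q _ _) (q⊆p∪q _ _ ∘ q⊆p∪q _ _))

  lineClosure⊆closure : ∀ {X k} → InLineClosure G X k → InClosure G X k
  lineClosure⊆closure {X} k∈lc = ∈cl⁻ (k∈lc (cl X) (X⊆clX X) (clX-lineClosed X))

  Dependent : Subset n → Set
  Dependent X = rk X < ∣ X ∣

  dependent⇒circuit : ∀ X → Acc _<_ ∣ X ∣ → Dependent X → ∃ λ C → C ⊆ X × Circuit G C
  dependent⇒circuit X (acc rs) dep
    with anySubset? (λ D → D ⊂? X ×-dec rk D <? ∣ D ∣)
  ... | yes (D , D⊂X , depD) with dependent⇒circuit D (rs (p⊂q⇒∣p∣<∣q∣ D⊂X)) depD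
  ...   | C , C⊆D , circuit = C , ⊆-trans C⊆D (p⊂q⇒p⊆q D⊂X) , circuit
  dependent⇒circuit X (acc rs) dep | no ∄smaller =
    X , id , dep , λ D D⊂X → ≤-antisym (rk-bounded D) (≮⇒≥ λ depD → ∄smaller (D , D⊂X , depD))

  NBC⇒circuit⊈∪lowerBound : ∀ {S X C k} → NBC G S → X ⊆ S → StrictLowerBound k X →
                           Circuit G C → ¬ (C ⊆ X ∪ ⁅ k ⁆)
  NBC⇒circuit⊈∪lowerBound {C = C} nbc X⊆S k<X circuit C⊆X∪k
    with m , m∈C , m≤C ← least-∈ C (≤-<-trans z≤n (proj₁ circuit)) =
    nbc (C - m) (C , circuit , m , m∈C , m≤C , refl)
        (⊆-trans (drop-least-⊆ C⊆X∪k k<X m∈C m≤C) X⊆S)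

  closure∉⇒∪-dependent : ∀ {X k} → InClosure G X k → k ∉ X → Dependent (X ∪ ⁅ k ⁆)
  closure∉⇒∪-dependent {X} {k} k∈clX k∉X = begin-strict
    rk (X ∪ ⁅ k ⁆)  ≡⟨ k∈clX ⟩
    rk X            ≤⟨ rk-bounded X ⟩
    ∣ X ∣           <⟨ p⊂q⇒∣p∣<∣q∣ (p⊆p∪q _ , k , q⊆p∪q X _ (x∈⁅x⁆ k) , k∉X) ⟩
    ∣ X ∪ ⁅ k ⁆ ∣   ∎
    where open ≤-Reasoning

  NBC⇒lowerBound∉closure : ∀ {S X k} → NBC G S → X ⊆ S → StrictLowerBound k X →
                          ¬ InClosure G X k
  NBC⇒lowerBound∉closure {X = X} {k} nbc X⊆S k<X k∈clX
    with C , C⊆X∪k , circuit ← dependent⇒circuit (X ∪ ⁅ k ⁆) (<-wellFounded _)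
                                 (closure∉⇒∪-dependent k∈clX λ k∈X → <-irrefl refl (k<X k k∈X)) =
    NBC⇒circuit⊈∪lowerBound nbc X⊆S k<X circuit C⊆X∪k

  tailFrom⁻ : ∀ {S} i {j} → j ∈ tailFrom G S i → j ∈ S × i Fin.≤ j
  tailFrom⁻ {S} i {j} j∈ with j∈S , j∈≥i ← x∈p∩q⁻ S _ j∈ =
    j∈S , ≤ᵇ⇒≤ (toℕ i) (toℕ j) (x∈tabulate⁻ (λ j → toℕ i ℕ.≤ᵇ toℕ j) j∈≥i)

  tailFrom-mono : ∀ {S T} i → T ⊆ S → tailFrom G T i ⊆ tailFrom G S i
  tailFrom-mono {S} {T} i T⊆S j∈ with j∈T , j∈≥i ← x∈p∩q⁻ T _ j∈ = x∈p∩q⁺ (T⊆S j∈T , j∈≥i)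

  lineClosure-mono : ∀ {X Y k} → X ⊆ Y → InLineClosure G X k → InLineClosure G Y k
  lineClosure-mono X⊆Y k∈lcX Z Y⊆Z = k∈lcX Z (Y⊆Z ∘ X⊆Y)

  NBB-⊆ : ∀ S T → T ⊆ S → NBB G S → NBB G T
  NBB-⊆ S T T⊆S nbb i i∈T k k∈lc = nbb i (T⊆S i∈T) k (lineClosure-mono (tailFrom-mono i T⊆S) k∈lc)

  NBC-⊆ : ∀ S T → T ⊆ S → NBC G S → NBC G T
  NBC-⊆ S T T⊆S nbc B broken B⊆T = nbc B broken (T⊆S ∘ B⊆T)

  NBC⇒NBB : ∀ S → NBC G S → NBB G S
  NBC⇒NBB S nbc i i∈S k k∈lc = ≮⇒≥ λ k<i →
    NBC⇒lowerBound∉closure nbc (proj₁ ∘ tailFrom⁻ i)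
      (λ j j∈tail → <-≤-trans k<i (proj₂ (tailFrom⁻ i j∈tail)))
      (lineClosure⊆closure k∈lc)

theorem2p11 : (n : ℕ) (G : Matroid n) → Loopless G → NoMultiplePoints G →
    ((S T : Subset n) → T ⊆ S → NBB G S → NBB G T)
    × ((S T : Subset n) → T ⊆ S → NBC G S → NBC G T)
    × ((S : Subset n) → NBC G S → NBB G S)
theorem2p11 n G _ _ = NBB-⊆ G , NBC-⊆ G , NBC⇒NBB G
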